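{- Let $G$ be a bipartite graph with bipartition $\{A,B\}$. Let $S$ be a star with at least $|A|$ leaves, and let $T$ be any tree with at least $|B|$ vertices. Then $G$ is a minor of $S\mathbin{\Box} T$.
   Context: All graphs are finite, simple and undirected. A star is a tree consisting of one root vertex adjacent to all other vertices (the leaves). The Cartesian product $G_1\mathbin{\Box} G_2$ has vertex set $V(G_1)\times V(G_2)$ with distinct $(u_1,u_2),(v_1,v_2)$ adjacent iff ($u_1=v_1$ and $u_2v_2\in E(G_2)$) or ($u_2=v_2$ and $u_1v_1\in E(G_1)$). -}

module Defs where

open import Data.Nat using (ℕ; suc; _+_)
open import Data.Fin using (Fin; zero; suc; inject₁; fromℕ)
open import Data.Product using (Σ; ∃; ∃₂; _×_; _,_)
open import Data.Sum using (_⊎_; inj₁; inj₂)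
open import Data.Maybe using (Maybe; just)
open import Data.Unit using (⊤)
open import Data.Empty using (⊥)
open import Relation.Nullary using (¬_)
open import Relation.Binary.PropositionalEquality using (_≡_; _≢_; refl; sym)
open import Function.Definitions using (Injective)

record Graph (V : Set) : Set₁ where
  field
    E      : V → V → Set
    E-sym  : ∀ {x y} → E x y → E y x
    E-irr  : ∀ {x} → ¬ E x x
open Graph public

data Walk {V : Set} (H : Graph V) (P : V → Set) : V → V → Set where
  nil  : ∀ {x} → P x → Walk H P x x
  cons : ∀ {x y z} → P x → E H x y → Walk H P y z → Walk H P x z

Connected : {V : Set} → Graph V → Set
Connected H = ∀ x y → Walk H (λ _ → ⊤) x y

record Cycle {V : Set} (H : Graph V) : Set where
  field
    k    : ℕ
    c    : Fin (3 + k) → V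
    inj  : Injective _≡_ _≡_ c
    step : ∀ (i : Fin (2 + k)) → E H (c (inject₁ i)) (c (suc i))
    close : E H (c (fromℕ (2 + k))) (c zero)

Acyclic : {V : Set} → Graph V → Set
Acyclic H = ¬ Cycle H

IsTree : {V : Set} → Graph V → Set
IsTree {V} H = V × Connected H × Acyclic H

-- The star with l leaves: root zero, leaves suc i.
star-E : ∀ {l} → Fin (suc l) → Fin (suc l) → Set
star-E x y = (x ≡ zero × y ≢ zero) ⊎ (y ≡ zero × x ≢ zero)

star : (l : ℕ) → Graph (Fin (suc l))
star l = record { E = star-E ; E-sym = s ; E-irr = i }
  where
    s : ∀ {x y} → star-E x y → star-E y x
    s (inj₁ p) = inj₂ p
    s (inj₂ p) = inj₁ p
    i : ∀ {x} → ¬ star-E x x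
    i (inj₁ (p , q)) = q p
    i (inj₂ (p , q)) = q p

□-E : {V W : Set} → Graph V → Graph W → V × W → V × W → Set
□-E G H (u₁ , u₂) (v₁ , v₂) = (u₁ ≡ v₁ × E H u₂ v₂) ⊎ (u₂ ≡ v₂ × E G u₁ v₁)

_□_ : {V W : Set} → Graph V → Graph W → Graph (V × W)
G □ H = record { E = □-E G H ; E-sym = s ; E-irr = i }
  where
    s : ∀ {x y} → □-E G H x y → □-E G H y x
    s (inj₁ (p , e)) = inj₁ (sym p , E-sym H e)
    s (inj₂ (p , e)) = inj₂ (sym p , E-sym G e)
    i : ∀ {x} → ¬ □-E G H x x
    i (inj₁ (_ , e)) = E-irr H e
    i (inj₂ (_ , e)) = E-irr G e

-- G is a minor of H, via a minor model: branch x = just v means vertex x of H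
-- lies in the branch set of v (so branch sets are pairwise disjoint);
-- branch sets are nonempty, induce connected subgraphs of H, and every edge
-- uv of G is realised by an edge of H between the branch sets of u and v.
record _≼_ {V W : Set} (G : Graph V) (H : Graph W) : Set where
  field
    branch    : W → Maybe V
    nonempty  : ∀ v → ∃ λ x → branch x ≡ just v
    connected : ∀ v x y → branch x ≡ just v → branch y ≡ just v →
                Walk H (λ z → branch z ≡ just v) x y
    edges     : ∀ u v → E G u v →
                ∃₂ λ x y → branch x ≡ just u × branch y ≡ just v × E H x y

IsMinorOf : {V W : Set} → Graph V → Graph W → Set
IsMinorOf G H = G ≼ H

module Submission where

open import Defs
open import Data.Nat using (ℕ; _≤_; s≤s)
import Data.Nat as ℕ
open import Data.Fin using (Fin; zero; suc)
open import Data.Fin.Subset using (Subset; _∈_; _∉_; ∁; ∣_∣; inside; outside)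
open import Data.Fin.Subset.Properties using (_∈?_; x∈∁p⇒x∉p; x∉p⇒x∈∁p)
open import Data.Vec using ([]; _∷_; here; there)
open import Data.Product using (_×_; _,_; ∃)
open import Data.Sum using (_⊎_; inj₁; inj₂)
open import Data.Maybe using (Maybe; just; nothing)
import Data.Maybe as Maybe
open import Data.Unit using (⊤)
open import Data.Empty using (⊥-elim)
open import Relation.Nullary using (yes; no)
open import Relation.Binary.PropositionalEquality using (_≡_; _≢_; refl; cong)

-- List A along the leaves of S and B along the vertices of T.
-- The branch set of a ∈ A is the whole copy of T at the leaf listing a, which is
-- connected because T is; the branch set of b ∈ B is the single vertex of the
-- root copy of T at the vertex listing b. An edge ab of G is then realised by
-- the star edge between the root and the leaf of a inside the copy of S at b.

record Listing {n : ℕ} (W : Set) (A : Subset n) : Set where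
  field
    slot       : W → Maybe (Fin n)
    surjective : ∀ x → x ∈ A → ∃ λ w → slot w ≡ just x
    within     : ∀ w x → slot w ≡ just x → x ∈ A
    injective  : ∀ {v w x} → slot v ≡ just x → slot w ≡ just x → v ≡ w

map-suc≢just-zero : ∀ {n} (m : Maybe (Fin n)) → Maybe.map suc m ≢ just zero
map-suc≢just-zero (just _) ()
map-suc≢just-zero nothing ()

map-suc≡just-suc : ∀ {n} (m : Maybe (Fin n)) {x} → Maybe.map suc m ≡ just (suc x) → m ≡ just x
map-suc≡just-suc (just _) refl = refl

listing-outside : ∀ {n} {W : Set} {A : Subset n} → Listing W A → Listing W (outside ∷ A)
listing-outside {W = W} {A} L = record
  { slot = slot′ ; surjective = surjective′ ; within = within′ ; injective = injective′ }
  where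
    open Listing L
    slot′ : W → Maybe (Fin _)
    slot′ w = Maybe.map suc (slot w)
    surjective′ : ∀ x → x ∈ (outside ∷ A) → ∃ λ w → slot′ w ≡ just x
    surjective′ (suc x) (there x∈A) = let (w , eq) = surjective x x∈A in w , cong (Maybe.map suc) eq
    within′ : ∀ w x → slot′ w ≡ just x → x ∈ (outside ∷ A)
    within′ w zero eq = ⊥-elim (map-suc≢just-zero (slot w) eq)
    within′ w (suc x) eq = there (within w x (map-suc≡just-suc (slot w) eq))
    injective′ : ∀ {v w x} → slot′ v ≡ just x → slot′ w ≡ just x → v ≡ w
    injective′ {v} {x = zero} eq _ = ⊥-elim (map-suc≢just-zero (slot v) eq)
    injective′ {v} {w} {suc x} eq eq′ =
      injective (map-suc≡just-suc (slot v) eq) (map-suc≡just-suc (slot w) eq′)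

listing-inside : ∀ {n k} {A : Subset n} → Listing (Fin k) A → Listing (Fin (ℕ.suc k)) (inside ∷ A)
listing-inside {n} {k} {A} L = record
  { slot = slot′ ; surjective = surjective′ ; within = within′ ; injective = injective′ }
  where
    open Listing L
    slot′ : Fin (ℕ.suc k) → Maybe (Fin (ℕ.suc n))
    slot′ zero = just zero
    slot′ (suc i) = Maybe.map suc (slot i)
    surjective′ : ∀ x → x ∈ (inside ∷ A) → ∃ λ i → slot′ i ≡ just x
    surjective′ zero here = zero , refl
    surjective′ (suc x) (there x∈A) = let (i , eq) = surjective x x∈A in suc i , cong (Maybe.map suc) eq
    within′ : ∀ i x → slot′ i ≡ just x → x ∈ (inside ∷ A)
    within′ zero zero refl = here
    within′ (suc i) zero eq = ⊥-elim (map-suc≢just-zero (slot i) eq)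
    within′ (suc i) (suc x) eq = there (within i x (map-suc≡just-suc (slot i) eq))
    injective′ : ∀ {i j x} → slot′ i ≡ just x → slot′ j ≡ just x → i ≡ j
    injective′ {zero} {zero} _ _ = refl
    injective′ {zero} {suc j} refl eq = ⊥-elim (map-suc≢just-zero (slot j) eq)
    injective′ {suc i} {zero} eq refl = ⊥-elim (map-suc≢just-zero (slot i) eq)
    injective′ {suc i} {suc j} {zero} eq _ = ⊥-elim (map-suc≢just-zero (slot i) eq)
    injective′ {suc i} {suc j} {suc x} eq eq′ =
      cong suc (injective (map-suc≡just-suc (slot i) eq) (map-suc≡just-suc (slot j) eq′))

listing : ∀ {n k} (A : Subset n) → ∣ A ∣ ≤ k → Listing (Fin k) A
listing [] _ = record
  { slot = λ _ → nothing ; surjective = λ () ; within = λ _ _ () ; injective = λ () }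
listing (outside ∷ A) ∣A∣≤k = listing-outside (listing A ∣A∣≤k)
listing {k = ℕ.suc k} (inside ∷ A) (s≤s ∣A∣≤k) = listing-inside (listing A ∣A∣≤k)

walk-in-column : ∀ {V W : Set} (S : Graph V) (T : Graph W) {P : V × W → Set} (s : V) →
                 (∀ t → P (s , t)) → ∀ {t t′} → Walk T (λ _ → ⊤) t t′ →
                 Walk (S □ T) P (s , t) (s , t′)
walk-in-column S T s P-col (nil _) = nil (P-col _)
walk-in-column S T s P-col (cons _ e w) = cons (P-col _) (inj₁ (refl , e)) (walk-in-column S T s P-col w)

Bipartition : ∀ {n} → Graph (Fin n) → Subset n → Set
Bipartition {n} G A = ∀ x y → E G x y → (x ∈ A × y ∉ A) ⊎ (x ∉ A × y ∈ A)

bipartite-≼-star□connected :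
  ∀ {n l} {W : Set} (G : Graph (Fin n)) (A : Subset n) → Bipartition G A →
  Listing (Fin l) A → (T : Graph W) → W → Connected T → Listing W (∁ A) →
  G ≼ (star l □ T)
bipartite-≼-star□connected {n} {l} {W} G A bip LA T t₀ conn LB =
  record { branch = branch ; nonempty = nonempty ; connected = connected ; edges = edges }
  where
    module LA = Listing LA
    module LB = Listing LB
    branch : Fin (ℕ.suc l) × W → Maybe (Fin n)
    branch (zero , t) = LB.slot t
    branch (suc i , _) = LA.slot i
    nonempty : ∀ v → ∃ λ x → branch x ≡ just v
    nonempty v with v ∈? A
    ... | yes v∈A = let (i , eq) = LA.surjective v v∈A in (suc i , t₀) , eq
    ... | no v∉A = let (t , eq) = LB.surjective v (x∉p⇒x∈∁p v∉A) in (zero , t) , eq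
    connected : ∀ v x y → branch x ≡ just v → branch y ≡ just v →
                Walk (star l □ T) (λ z → branch z ≡ just v) x y
    connected v (zero , t) (zero , t′) p q with LB.injective p q
    ... | refl = nil p
    connected v (zero , t) (suc j , _) p q = ⊥-elim (x∈∁p⇒x∉p (LB.within t v p) (LA.within j v q))
    connected v (suc i , _) (zero , t′) p q = ⊥-elim (x∈∁p⇒x∉p (LB.within t′ v q) (LA.within i v p))
    connected v (suc i , t) (suc j , t′) p q with LA.injective p q
    ... | refl = walk-in-column (star l) T (suc i) (λ _ → p) (conn t t′)
    edges : ∀ u v → E G u v →
            ∃ λ x → ∃ λ y → branch x ≡ just u × branch y ≡ just v × E (star l □ T) x y
    edges u v e with bip u v e
    ... | inj₁ (u∈A , v∉A) =
      let (i , eqᵢ) = LA.surjective u u∈A ; (t , eqₜ) = LB.surjective v (x∉p⇒x∈∁p v∉A)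
      in (suc i , t) , (zero , t) , eqᵢ , eqₜ , inj₂ (refl , inj₂ (refl , λ ()))
    ... | inj₂ (u∉A , v∈A) =
      let (i , eqᵢ) = LA.surjective v v∈A ; (t , eqₜ) = LB.surjective u (x∉p⇒x∈∁p u∉A)
      in (zero , t) , (suc i , t) , eqₜ , eqᵢ , inj₂ (refl , inj₁ (refl , λ ()))

lemma14 : (n : ℕ) (G : Graph (Fin n)) (A : Subset n) →
          (∀ x y → E G x y → (x ∈ A × y ∉ A) ⊎ (x ∉ A × y ∈ A)) →
          (l : ℕ) → ∣ A ∣ ≤ l →
          (m : ℕ) (T : Graph (Fin m)) → IsTree T → ∣ ∁ A ∣ ≤ m →
          IsMinorOf G (star l □ T)
lemma14 n G A bip l ∣A∣≤l m T (t₀ , conn , _) ∣B∣≤m =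
  bipartite-≼-star□connected G A bip (listing A ∣A∣≤l) T t₀ conn (listing (∁ A) ∣B∣≤m)
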